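{- Let $T=\{123,231,312\}$, $k\geq 1$, and $\tau\in S_k(T)$. Then: (i) there exists $r$ with $1\leq r\leq k$ such that $\tau=(r,r-1,\dots,2,1,\;k,k-1,\dots,r+1)$; (ii) for every $r$ with $1\leq r\leq k-1$ and all $n\geq k$, $$|S_n(T,(r,\dots,2,1,k,\dots,r+1))|=k-1.$$
   Context: Permutations are written in one-line notation (the run $k,\dots,r+1$ is empty when $r=k$); $S_k$ is the set of permutations of $\{1,\dots,k\}$. A permutation $\alpha\in S_n$ contains a pattern $\beta$ if some subsequence of $\alpha$ is order-isomorphic to $\beta$; otherwise it avoids $\beta$. $S_n(T,\tau)$ is the set of permutations in $S_n$ avoiding all patterns in $T$ and $\tau$. -}

module Defs where

open import Data.Nat using (ℕ; zero; suc; _+_; _∸_; _<_)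
open import Data.List using (List; []; _∷_; _++_; map; length; lookup; upTo)
open import Data.List.Relation.Binary.Permutation.Propositional using (_↭_)
open import Data.List.Relation.Binary.Sublist.Propositional using (_⊆_)
open import Data.List.Relation.Unary.Unique.Propositional using (Unique)
open import Data.List.Membership.Propositional using (_∈_)
open import Data.Fin using (Fin; cast)
open import Data.Product using (Σ; ∃; _×_)
open import Function.Bundles using (_⇔_)
open import Relation.Binary.PropositionalEquality using (_≡_)
open import Relation.Nullary using (¬_)

oneTo : ℕ → List ℕ
oneTo n = map suc (upTo n)

-- σ ∈ S_n : σ (one-line notation) is a rearrangement of 1..n
IsPerm : ℕ → List ℕ → Set
IsPerm n σ = σ ↭ oneTo n

OrdIso : List ℕ → List ℕ → Set
OrdIso xs ys = Σ (length xs ≡ length ys) λ eq →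
  ∀ (i j : Fin (length xs)) →
    (lookup xs i < lookup xs j) ⇔ (lookup ys (cast eq i) < lookup ys (cast eq j))

Contains : List ℕ → List ℕ → Set
Contains α β = ∃ λ γ → γ ⊆ α × OrdIso γ β

Avoids : List ℕ → List ℕ → Set
Avoids α β = ¬ Contains α β

AvoidsT : List ℕ → Set
AvoidsT α = Avoids α (1 ∷ 2 ∷ 3 ∷ []) × Avoids α (2 ∷ 3 ∷ 1 ∷ []) × Avoids α (3 ∷ 1 ∷ 2 ∷ [])

InSnTτ : ℕ → List ℕ → List ℕ → Set
InSnTτ n τ σ = IsPerm n σ × AvoidsT σ × Avoids σ τ

dec : ℕ → List ℕ
dec zero = []
dec (suc n) = suc n ∷ dec n

-- pat k r = (r, r-1, ..., 1, k, k-1, ..., r+1)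
pat : ℕ → ℕ → List ℕ
pat k r = dec r ++ map (λ x → x + r) (dec (k ∸ r))

HasSize : (List ℕ → Set) → ℕ → Set
HasSize P m = ∃ λ (L : List (List ℕ)) →
  Unique L × length L ≡ m × (∀ σ → (σ ∈ L) ⇔ P σ)

module Submission where

-- A permutation avoiding 123, 231 and 312 starts with some value r, followed by a decreasing
-- run of the values below r and then a decreasing run of the values above r.  Such a layered
-- permutation is determined by r, which gives (i).  A subsequence of pat n s is again two
-- decreasing runs, the first entirely below the second; matching the unique ascent of
-- pat k r, at positions r − 1 and r, forces the runs to have lengths r and k − r.  Hence
-- pat n s contains pat k r iff r ≤ s and k − r ≤ n − s, and the avoiders among the n layered
-- permutations are those with s < r or s > n − k + r: there are k − 1 of them.

open import Defs
open import Data.Nat using (ℕ; zero; suc; _+_; _∸_; _≤_; _<_; _>_; z≤n; s≤s; z<s; s<s; s≤s⁻¹; s<s⁻¹; _≤?_; _<?_)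
open import Data.Nat.Properties
open import Data.List using (List; []; _∷_; _++_; map; length; lookup; upTo)
open import Data.List.Properties using (length-map; length-++; map-++; length-upTo; applyUpTo-∷ʳ; ∷-injectiveˡ; map-∘; map-cong)
open import Data.List.Membership.Propositional using (_∈_)
open import Data.List.Membership.Propositional.Properties using (∈-map⁺; ∈-map⁻; ∈-++⁺ˡ; ∈-++⁺ʳ; ∈-++⁻; ∈-upTo⁺; ∈-upTo⁻)
open import Data.List.Relation.Unary.Any using (here; there)
open import Data.List.Relation.Unary.All as All using (All; []; _∷_)
open import Data.List.Relation.Unary.All.Properties using (++⁻ˡ)
open import Data.List.Relation.Unary.AllPairs as AllPairs using (AllPairs; []; _∷_)
import Data.List.Relation.Unary.AllPairs.Properties as AllPairsₚ
open import Data.List.Relation.Unary.Unique.Propositional using (Unique)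
import Data.List.Relation.Unary.Unique.Propositional.Properties as Unique
open import Data.List.Relation.Binary.Sublist.Propositional using (_⊆_; []; _∷_; _∷ʳ_; ⊆-refl; ⊆-trans; from∈)
open import Data.List.Relation.Binary.Sublist.Propositional.Properties using (++⁺; map⁺; length-mono-≤; All-resp-⊆)
open import Data.List.Relation.Binary.Permutation.Propositional using (_↭_; ↭-refl; ↭-sym; ↭-trans; ↭-prep; ↭⇒↭ₛ; module PermutationReasoning)
open import Data.List.Relation.Binary.Permutation.Propositional.Properties using (∈-resp-↭; ++-comm; ∷↭∷ʳ)
import Data.List.Relation.Binary.Permutation.Setoid.Properties as Permutationₛ
open import Data.Fin using (Fin; zero; suc; toℕ; fromℕ<; cast)
open import Data.Fin.Properties using (toℕ-cast; toℕ-fromℕ<)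
open import Data.Product using (Σ; ∃; ∃₂; _×_; _,_; proj₁; proj₂)
open import Data.Sum using (_⊎_; inj₁; inj₂)
open import Data.Empty using (⊥-elim)
open import Function using (_∘_; id)
open import Function.Bundles using (_⇔_; mk⇔; Equivalence)
open import Relation.Binary.Definitions using (tri<; tri≈; tri>)
open import Relation.Binary.PropositionalEquality
open import Relation.Nullary using (¬_; yes; no; contradiction)

-- Positions and order-isomorphism

-- Total indexing by ℕ (junk value 0 out of range), so that positions can be computed with.
at : List ℕ → ℕ → ℕ
at []       _       = 0
at (x ∷ xs) zero    = x
at (x ∷ xs) (suc p) = at xs p

at-lookup : ∀ xs (i : Fin (length xs)) → lookup xs i ≡ at xs (toℕ i)
at-lookup (x ∷ xs) zero    = refl
at-lookup (x ∷ xs) (suc i) = at-lookup xs i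

at-++ˡ : ∀ xs {ys p} → p < length xs → at (xs ++ ys) p ≡ at xs p
at-++ˡ (x ∷ xs) {p = zero}  _         = refl
at-++ˡ (x ∷ xs) {p = suc p} (s<s p<n) = at-++ˡ xs p<n

at-++ʳ : ∀ xs {ys p} → length xs ≤ p → at (xs ++ ys) p ≡ at ys (p ∸ length xs)
at-++ʳ []       _         = refl
at-++ʳ (x ∷ xs) (s≤s n≤p) = at-++ʳ xs n≤p

offset-<-length : ∀ (xs : List ℕ) {ys q} → length xs ≤ q → q < length (xs ++ ys) → q ∸ length xs < length ys
offset-<-length []       _         q<n       = q<n
offset-<-length (x ∷ xs) (s≤s n≤q) (s<s q<n) = offset-<-length xs n≤q q<n

All-at : ∀ {P : ℕ → Set} {xs} → All P xs → ∀ {p} → p < length xs → P (at xs p)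
All-at (px ∷ _)   {p = zero}  _         = px
All-at (_  ∷ pxs) {p = suc p} (s<s p<n) = All-at pxs p<n

Descending : List ℕ → Set
Descending = AllPairs _>_

Descending-at : ∀ {xs} → Descending xs → ∀ {p q} → p < q → q < length xs → at xs q < at xs p
Descending-at (x>xs ∷ _)    {p = zero}  {suc q} _         (s<s q<n) = All-at x>xs q<n
Descending-at (_    ∷ desc) {p = suc p} {suc q} (s<s p<q) (s<s q<n) = Descending-at desc p<q q<n

<⇔<-resp-≡ : ∀ {a a′ b b′ c c′ d d′ : ℕ} → a ≡ a′ → b ≡ b′ → c ≡ c′ → d ≡ d′ →
             (a < b) ⇔ (c < d) → (a′ < b′) ⇔ (c′ < d′)
<⇔<-resp-≡ refl refl refl refl = id

ordIso-at : ∀ {γ β p q} → OrdIso γ β → p < length β → q < length β →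
            (at γ p < at γ q) ⇔ (at β p < at β q)
ordIso-at {γ} {β} (eq , iso) p<n q<n =
  <⇔<-resp-≡ (γ-at p<n) (γ-at q<n) (β-at p<n) (β-at q<n) (iso (index p<n) (index q<n))
  where
  index : ∀ {p} → p < length β → Fin (length γ)
  index p<n = fromℕ< (subst (_ <_) (sym eq) p<n)
  γ-at : ∀ {p} (p<n : p < length β) → lookup γ (index p<n) ≡ at γ p
  γ-at p<n = trans (at-lookup γ _) (cong (at γ) (toℕ-fromℕ< _))
  β-at : ∀ {p} (p<n : p < length β) → lookup β (cast eq (index p<n)) ≡ at β p
  β-at p<n = trans (at-lookup β _) (cong (at β) (trans (toℕ-cast eq _) (toℕ-fromℕ< _)))

lookup-map : ∀ (g : ℕ → ℕ) xs (i : Fin (length (map g xs))) →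
             lookup (map g xs) i ≡ g (lookup xs (cast (length-map g xs) i))
lookup-map g (x ∷ xs) zero    = refl
lookup-map g (x ∷ xs) (suc i) = lookup-map g xs i

strictMono⇒<⇔< : ∀ {g : ℕ → ℕ} → (∀ {a b} → a < b → g a < g b) → ∀ {a b} → (g a < g b) ⇔ (a < b)
strictMono⇒<⇔< {g} mono {a} {b} = mk⇔ reflect mono
  where
  reflect : g a < g b → a < b
  reflect ga<gb with <-cmp a b
  ... | tri< a<b _ _    = a<b
  ... | tri≈ _ refl _   = contradiction ga<gb (<-irrefl refl)
  ... | tri> _ _ b<a    = contradiction ga<gb (<-asym (mono b<a))

ordIso-map : ∀ {g : ℕ → ℕ} → (∀ {a b} → a < b → g a < g b) → ∀ xs → OrdIso (map g xs) xs
ordIso-map {g} mono xs = length-map g xs , λ i j →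
  <⇔<-resp-≡ (sym (lookup-map g xs i)) (sym (lookup-map g xs j)) refl refl (strictMono⇒<⇔< mono)

SameOrder : ℕ → ℕ → ℕ → ℕ → Set
SameOrder a b c d = (a < b × c < d) ⊎ (b < a × d < c)

sameOrder⇒<⇔< : ∀ {a b c d} → SameOrder a b c d → (a < b) ⇔ (c < d)
sameOrder⇒<⇔< (inj₁ (a<b , c<d)) = mk⇔ (λ _ → c<d) (λ _ → a<b)
sameOrder⇒<⇔< (inj₂ (b<a , d<c)) = mk⇔ (⊥-elim ∘ <-asym b<a) (⊥-elim ∘ <-asym d<c)

sameOrder-swap : ∀ {a b c d} → SameOrder a b c d → SameOrder b a d c
sameOrder-swap (inj₁ ordered) = inj₂ ordered
sameOrder-swap (inj₂ ordered) = inj₁ ordered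

<-irrefl⇔ : ∀ {a b : ℕ} → (a < a) ⇔ (b < b)
<-irrefl⇔ = mk⇔ (⊥-elim ∘ <-irrefl refl) (⊥-elim ∘ <-irrefl refl)

ordIso₃ : ∀ {x y z a b c} → SameOrder x y a b → SameOrder x z a c → SameOrder y z b c →
          OrdIso (x ∷ y ∷ z ∷ []) (a ∷ b ∷ c ∷ [])
ordIso₃ xy xz yz = refl , λ where
  zero             zero             → <-irrefl⇔
  zero             (suc zero)       → sameOrder⇒<⇔< xy
  zero             (suc (suc zero)) → sameOrder⇒<⇔< xz
  (suc zero)       zero             → sameOrder⇒<⇔< (sameOrder-swap xy)
  (suc zero)       (suc zero)       → <-irrefl⇔
  (suc zero)       (suc (suc zero)) → sameOrder⇒<⇔< yz
  (suc (suc zero)) zero             → sameOrder⇒<⇔< (sameOrder-swap xz)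
  (suc (suc zero)) (suc zero)       → sameOrder⇒<⇔< (sameOrder-swap yz)
  (suc (suc zero)) (suc (suc zero)) → <-irrefl⇔

contains-self : ∀ {xs β} → OrdIso xs β → Contains xs β
contains-self iso = _ , ⊆-refl , iso

Avoids-⊆ : ∀ {xs ys β} → ys ⊆ xs → Avoids xs β → Avoids ys β
Avoids-⊆ ys⊆xs avoids (γ , γ⊆ys , iso) = avoids (γ , ⊆-trans γ⊆ys ys⊆xs , iso)

AvoidsT-⊆ : ∀ {xs ys} → ys ⊆ xs → AvoidsT xs → AvoidsT ys
AvoidsT-⊆ ys⊆xs (a , b , c) = Avoids-⊆ ys⊆xs a , Avoids-⊆ ys⊆xs b , Avoids-⊆ ys⊆xs c

contains-123 : ∀ {x y z} → x < y → y < z → Contains (x ∷ y ∷ z ∷ []) (1 ∷ 2 ∷ 3 ∷ [])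
contains-123 x<y y<z = contains-self (ordIso₃ (inj₁ (x<y , s<s z<s)) (inj₁ (<-trans x<y y<z , s<s z<s))
                                              (inj₁ (y<z , s<s (s<s z<s))))

contains-231 : ∀ {x y z} → z < x → x < y → Contains (x ∷ y ∷ z ∷ []) (2 ∷ 3 ∷ 1 ∷ [])
contains-231 z<x x<y = contains-self (ordIso₃ (inj₁ (x<y , s<s (s<s z<s))) (inj₂ (z<x , s<s z<s))
                                              (inj₂ (<-trans z<x x<y , s<s z<s)))

contains-312 : ∀ {x y z} → y < z → z < x → Contains (x ∷ y ∷ z ∷ []) (3 ∷ 1 ∷ 2 ∷ [])
contains-312 y<z z<x = contains-self (ordIso₃ (inj₂ (<-trans y<z z<x , s<s z<s)) (inj₂ (z<x , s<s (s<s z<s)))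
                                              (inj₁ (y<z , s<s z<s)))

-- Layered sequences

⊆-++-split : ∀ {A : Set} (xs : List A) {ys zs} → zs ⊆ xs ++ ys →
             ∃₂ λ zs₁ zs₂ → zs ≡ zs₁ ++ zs₂ × zs₁ ⊆ xs × zs₂ ⊆ ys
⊆-++-split []       zs⊆ys = [] , _ , refl , [] , zs⊆ys
⊆-++-split (x ∷ xs) (.x ∷ʳ zs⊆) with ⊆-++-split xs zs⊆
... | zs₁ , zs₂ , refl , zs₁⊆ , zs₂⊆ = zs₁ , zs₂ , refl , x ∷ʳ zs₁⊆ , zs₂⊆
⊆-++-split (x ∷ xs) (refl ∷ zs⊆) with ⊆-++-split xs zs⊆
... | zs₁ , zs₂ , refl , zs₁⊆ , zs₂⊆ = x ∷ zs₁ , zs₂ , refl , refl ∷ zs₁⊆ , zs₂⊆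

AllPairs-resp-⊆ : ∀ {A : Set} {R : A → A → Set} {xs ys} → xs ⊆ ys → AllPairs R ys → AllPairs R xs
AllPairs-resp-⊆ []            []          = []
AllPairs-resp-⊆ (y ∷ʳ xs⊆ys)  (_ ∷ rys)   = AllPairs-resp-⊆ xs⊆ys rys
AllPairs-resp-⊆ (refl ∷ xs⊆ys) (ry ∷ rys) = All-resp-⊆ xs⊆ys ry ∷ AllPairs-resp-⊆ xs⊆ys rys

record Layered (s : ℕ) (xs : List ℕ) : Set where
  field
    low high        : List ℕ
    split           : xs ≡ low ++ high
    low-descending  : Descending low
    high-descending : Descending high
    low-≤           : All (_≤ s) low
    high->          : All (s <_) high
open Layered

Layered-⊆ : ∀ {s xs ys} → ys ⊆ xs → (L : Layered s xs) →
            Σ (Layered s ys) λ L′ → low L′ ⊆ low L × high L′ ⊆ high L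
Layered-⊆ ys⊆ record { low = lo ; split = refl ; low-descending = dl ; high-descending = dh
                     ; low-≤ = l≤ ; high-> = h> }
  with ⊆-++-split lo ys⊆
... | zs₁ , zs₂ , refl , zs₁⊆ , zs₂⊆ =
  record { low = zs₁ ; high = zs₂ ; split = refl
         ; low-descending = AllPairs-resp-⊆ zs₁⊆ dl ; high-descending = AllPairs-resp-⊆ zs₂⊆ dh
         ; low-≤ = All-resp-⊆ zs₁⊆ l≤ ; high-> = All-resp-⊆ zs₂⊆ h> }
  , zs₁⊆ , zs₂⊆

layered-ascent : ∀ {s xs p q} (L : Layered s xs) → p < q → q < length xs → at xs p < at xs q →
                 p < length (low L) × length (low L) ≤ q
layered-ascent {p = p} {q} record { low = lo ; high = hi ; split = refl
                                  ; low-descending = dl ; high-descending = dh } p<q q<n ascent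
  with q <? length lo | p <? length lo
... | yes q<ℓ | _       = contradiction (Descending-at dl p<q q<ℓ)
                            (<-asym (subst₂ _<_ (at-++ˡ lo (<-trans p<q q<ℓ)) (at-++ˡ lo q<ℓ) ascent))
... | no  q≮ℓ | yes p<ℓ = p<ℓ , ≮⇒≥ q≮ℓ
... | no  q≮ℓ | no  p≮ℓ = contradiction (Descending-at dh (∸-monoˡ-< p<q (≮⇒≥ p≮ℓ))
                                                         (offset-<-length lo {hi} (≮⇒≥ q≮ℓ) q<n))
                            (<-asym (subst₂ _<_ (at-++ʳ lo (≮⇒≥ p≮ℓ)) (at-++ʳ lo (≮⇒≥ q≮ℓ)) ascent))

layered-straddle : ∀ {s xs p q} (L : Layered s xs) → p < length (low L) → length (low L) ≤ q →
                   q < length xs → at xs p < at xs q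
layered-straddle record { low = lo ; high = hi ; split = refl ; low-≤ = l≤ ; high-> = h> } p<ℓ ℓ≤q q<n =
  subst₂ _<_ (sym (at-++ˡ lo {hi} p<ℓ)) (sym (at-++ʳ lo {hi} ℓ≤q))
    (≤-<-trans (All-at l≤ p<ℓ) (All-at h> (offset-<-length lo {hi} ℓ≤q q<n)))

module _ {s γ β} (L : Layered s γ) (iso : OrdIso γ β) where

  private
    <-length-γ : ∀ {q} → q < length β → q < length γ
    <-length-γ = subst (_ <_) (sym (proj₁ iso))

  ordIso-ascent : ∀ {p q} → p < q → q < length β → at β p < at β q →
                  p < length (low L) × length (low L) ≤ q
  ordIso-ascent p<q q<n ascent = layered-ascent L p<q (<-length-γ q<n)
    (Equivalence.from (ordIso-at {γ} {β} iso (<-trans p<q q<n) q<n) ascent)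

  ordIso-straddle : ∀ {p q} → p < length (low L) → length (low L) ≤ q → q < length β →
                    at β p < at β q
  ordIso-straddle p<ℓ ℓ≤q q<n =
    Equivalence.to (ordIso-at {γ} {β} iso (<-≤-trans p<ℓ (≤-trans ℓ≤q (<⇒≤ q<n))) q<n)
    (layered-straddle L p<ℓ ℓ≤q (<-length-γ q<n))

layered-¬123 : ∀ {s γ} → Layered s γ → ¬ OrdIso γ (1 ∷ 2 ∷ 3 ∷ [])
layered-¬123 L iso with ordIso-ascent L iso z<s (s<s z<s) (s<s z<s)
                       | ordIso-ascent L iso (s<s z<s) (s<s (s<s z<s)) (s<s (s<s z<s))
... | _ , ℓ≤1 | 1<ℓ , _ = <-irrefl refl (<-≤-trans 1<ℓ ℓ≤1)

layered-¬231 : ∀ {s γ} → Layered s γ → ¬ OrdIso γ (2 ∷ 3 ∷ 1 ∷ [])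
layered-¬231 L iso with ordIso-ascent L iso z<s (s<s z<s) (s<s (s<s z<s))
... | 0<ℓ , ℓ≤1 = <-asym (ordIso-straddle L iso 0<ℓ (m≤n⇒m≤1+n ℓ≤1) (s<s (s<s z<s))) (s<s z<s)

layered-¬312 : ∀ {s γ} → Layered s γ → ¬ OrdIso γ (3 ∷ 1 ∷ 2 ∷ [])
layered-¬312 L iso with ordIso-ascent L iso (s<s z<s) (s<s (s<s z<s)) (s<s z<s)
... | 1<ℓ , ℓ≤2 = <-asym (ordIso-straddle L iso (<-trans z<s 1<ℓ) ℓ≤2 (s<s (s<s z<s))) (s<s (s<s z<s))

layered-avoidsT : ∀ {s xs} → Layered s xs → AvoidsT xs
layered-avoidsT {s} {xs} L = avoid layered-¬123 , avoid layered-¬231 , avoid layered-¬312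
  where
  avoid : ∀ {β} → (∀ {γ} → Layered s γ → ¬ OrdIso γ β) → Avoids xs β
  avoid ¬iso (γ , γ⊆xs , iso) = ¬iso (proj₁ (Layered-⊆ γ⊆xs L)) iso

descending-≡ : ∀ {xs ys} → Descending xs → Descending ys →
               (∀ {z} → z ∈ xs → z ∈ ys) → (∀ {z} → z ∈ ys → z ∈ xs) → xs ≡ ys
descending-≡ {[]}    {[]}    _ _ _ _ = refl
descending-≡ {[]}    {_ ∷ _} _ _ _ ys⊆xs with ys⊆xs (here refl)
... | ()
descending-≡ {_ ∷ _} {[]}    _ _ xs⊆ys _ with xs⊆ys (here refl)
... | ()
descending-≡ {x ∷ xs} {y ∷ ys} (x>xs ∷ dxs) (y>ys ∷ dys) xs⊆ys ys⊆xs with heads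
  where
  heads : x ≡ y
  heads with xs⊆ys (here refl) | ys⊆xs (here refl)
  ... | here x≡y   | _          = x≡y
  ... | there _    | here y≡x   = sym y≡x
  ... | there x∈ys | there y∈xs = contradiction (All.lookup y>ys x∈ys) (<-asym (All.lookup x>xs y∈xs))
... | refl = cong (x ∷_) (descending-≡ dxs dys (tail x>xs xs⊆ys) (tail y>ys ys⊆xs))
  where
  tail : ∀ {us vs} → All (x >_) us → (∀ {z} → z ∈ x ∷ us → z ∈ x ∷ vs) → ∀ {z} → z ∈ us → z ∈ vs
  tail x>us us⊆vs z∈us with us⊆vs (there z∈us)
  ... | here refl = contradiction (All.lookup x>us z∈us) (<-irrefl refl)
  ... | there z∈vs = z∈vs

layered-↭⇒≡ : ∀ {s xs ys} → Layered s xs → Layered s ys → xs ↭ ys → xs ≡ ys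
layered-↭⇒≡ {s} {xs} {ys} L L′ xs↭ys = begin
  xs                ≡⟨ split L ⟩
  low L ++ high L   ≡⟨ cong₂ _++_ lows highs ⟩
  low L′ ++ high L′ ≡⟨ sym (split L′) ⟩
  ys                ∎
  where
  open ≡-Reasoning
  transfer : ∀ {us vs} (M : Layered s us) (M′ : Layered s vs) → us ↭ vs →
             ∀ {z} → z ∈ low M ++ high M → z ∈ low M′ ++ high M′
  transfer M M′ us↭vs z∈ = subst (_ ∈_) (split M′) (∈-resp-↭ us↭vs (subst (_ ∈_) (sym (split M)) z∈))
  low→low : ∀ {us vs} (M : Layered s us) (M′ : Layered s vs) → us ↭ vs → ∀ {z} → z ∈ low M → z ∈ low M′
  low→low M M′ us↭vs z∈low with ∈-++⁻ (low M′) (transfer M M′ us↭vs (∈-++⁺ˡ z∈low))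
  ... | inj₁ z∈low′  = z∈low′
  ... | inj₂ z∈high′ = contradiction (All.lookup (low-≤ M) z∈low) (<⇒≱ (All.lookup (high-> M′) z∈high′))
  high→high : ∀ {us vs} (M : Layered s us) (M′ : Layered s vs) → us ↭ vs → ∀ {z} → z ∈ high M → z ∈ high M′
  high→high M M′ us↭vs z∈high with ∈-++⁻ (low M′) (transfer M M′ us↭vs (∈-++⁺ʳ (low M) z∈high))
  ... | inj₁ z∈low′  = contradiction (All.lookup (low-≤ M′) z∈low′) (<⇒≱ (All.lookup (high-> M) z∈high))
  ... | inj₂ z∈high′ = z∈high′
  lows : low L ≡ low L′
  lows = descending-≡ (low-descending L) (low-descending L′)
           (low→low L L′ xs↭ys) (low→low L′ L (↭-sym xs↭ys))
  highs : high L ≡ high L′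
  highs = descending-≡ (high-descending L) (high-descending L′)
            (high→high L L′ xs↭ys) (high→high L′ L (↭-sym xs↭ys))

-- Permutations avoiding T are layered

tail-layered : ∀ x rest → Unique rest → All (x ≢_) rest →
               (∀ {y z} → y ∷ z ∷ [] ⊆ rest → AvoidsT (x ∷ y ∷ z ∷ [])) → Layered x rest
tail-layered x [] _ _ _ = record { low = [] ; high = [] ; split = refl ; low-descending = []
                                 ; high-descending = [] ; low-≤ = [] ; high-> = [] }
tail-layered x (y ∷ ys) (y∉ys ∷ u) (x≢y ∷ x∉ys) avoids
  with tail-layered x ys u x∉ys (avoids ∘ (y ∷ʳ_)) | <-cmp y x
... | _ | tri≈ _ y≡x _ = contradiction (sym y≡x) x≢y
... | record { low = lo ; high = hi ; split = refl ; low-descending = dl ; high-descending = dh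
             ; low-≤ = l≤ ; high-> = h> } | tri< y<x _ _ =
  record { low = y ∷ lo ; high = hi ; split = refl ; low-descending = All.tabulate y>lo ∷ dl
         ; high-descending = dh ; low-≤ = <⇒≤ y<x ∷ l≤ ; high-> = h> }
  where
  below-x : ∀ {z} → z ∈ lo → z < x
  below-x z∈lo = ≤∧≢⇒< (All.lookup l≤ z∈lo) (≢-sym (All.lookup x∉ys (∈-++⁺ˡ z∈lo)))
  y>lo : ∀ {z} → z ∈ lo → z < y
  y>lo z∈lo = ≤∧≢⇒< (≮⇒≥ λ y<z → proj₂ (proj₂ (avoids (refl ∷ from∈ (∈-++⁺ˡ z∈lo))))
                                   (contains-312 y<z (below-x z∈lo)))
                    (≢-sym (All.lookup y∉ys (∈-++⁺ˡ z∈lo)))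
... | record { low = [] ; high = hi ; split = refl ; high-descending = dh ; high-> = h> } | tri> _ _ x<y =
  record { low = [] ; high = y ∷ hi ; split = refl ; low-descending = []
         ; high-descending = All.tabulate y>hi ∷ dh ; low-≤ = [] ; high-> = x<y ∷ h> }
  where
  y>hi : ∀ {z} → z ∈ hi → z < y
  y>hi z∈hi = ≤∧≢⇒< (≮⇒≥ λ y<z → proj₁ (avoids (refl ∷ from∈ z∈hi)) (contains-123 x<y y<z))
                    (≢-sym (All.lookup y∉ys z∈hi))
... | record { low = z ∷ lo ; split = refl ; low-≤ = z≤x ∷ _ } | tri> _ _ x<y =
  contradiction (contains-231 (≤∧≢⇒< z≤x (≢-sym (All.head x∉ys))) x<y)
                (proj₁ (proj₂ (avoids (refl ∷ from∈ (here refl)))))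

avoidsT⇒layered : ∀ {x rest} → Unique (x ∷ rest) → AvoidsT (x ∷ rest) → Layered x (x ∷ rest)
avoidsT⇒layered {x} {rest} (x∉rest ∷ u) avoids
  with tail-layered x rest u x∉rest (λ yz⊆rest → AvoidsT-⊆ (refl ∷ yz⊆rest) avoids)
... | record { low = lo ; high = hi ; split = refl ; low-descending = dl ; high-descending = dh
             ; low-≤ = l≤ ; high-> = h> } =
  record { low = x ∷ lo ; high = hi ; split = refl ; low-descending = x>lo ∷ dl
         ; high-descending = dh ; low-≤ = ≤-refl ∷ l≤ ; high-> = h> }
  where
  x>lo : All (_< x) lo
  x>lo = All.zipWith (λ (z≤x , x≢z) → ≤∧≢⇒< z≤x (≢-sym x≢z)) (l≤ , ++⁻ˡ lo x∉rest)

-- The layered permutations pat n s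

length-dec : ∀ n → length (dec n) ≡ n
length-dec zero    = refl
length-dec (suc n) = cong suc (length-dec n)

dec-≤ : ∀ n → All (_≤ n) (dec n)
dec-≤ zero    = []
dec-≤ (suc n) = ≤-refl ∷ All.map m≤n⇒m≤1+n (dec-≤ n)

dec-descending : ∀ n → Descending (dec n)
dec-descending zero    = []
dec-descending (suc n) = All.map s≤s (dec-≤ n) ∷ dec-descending n

map-+-dec-> : ∀ m s → All (s <_) (map (_+ s) (dec m))
map-+-dec-> zero    s = []
map-+-dec-> (suc m) s = s<s (m≤n+m s m) ∷ map-+-dec-> m s

dec-⊆ : ∀ {m n} → m ≤ n → dec m ⊆ dec n
dec-⊆ {n = zero}  z≤n = ⊆-refl
dec-⊆ {m} {suc n} m≤1+n with m≤n⇒m<n∨m≡n m≤1+n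
... | inj₁ (s<s m≤n) = suc n ∷ʳ dec-⊆ m≤n
... | inj₂ refl      = ⊆-refl

dec-+ : ∀ m n → dec (m + n) ≡ map (_+ n) (dec m) ++ dec n
dec-+ zero    n = refl
dec-+ (suc m) n = cong (suc (m + n) ∷_) (dec-+ m n)

oneTo-suc : ∀ n → oneTo (suc n) ≡ oneTo n ++ suc n ∷ []
oneTo-suc n = trans (cong (map suc) (sym (applyUpTo-∷ʳ id n))) (map-++ suc (upTo n) (n ∷ []))

dec-↭-oneTo : ∀ n → dec n ↭ oneTo n
dec-↭-oneTo zero    = ↭-refl
dec-↭-oneTo (suc n) = begin
  suc n ∷ dec n         ↭⟨ ↭-prep (suc n) (dec-↭-oneTo n) ⟩
  suc n ∷ oneTo n       ↭⟨ ∷↭∷ʳ (suc n) (oneTo n) ⟩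
  oneTo n ++ suc n ∷ [] ≡⟨ oneTo-suc n ⟨
  oneTo (suc n)         ∎
  where open PermutationReasoning

pat-isPerm : ∀ {n s} → s ≤ n → IsPerm n (pat n s)
pat-isPerm {n} {s} s≤n = begin
  dec s ++ map (_+ s) (dec (n ∸ s)) ↭⟨ ++-comm (dec s) _ ⟩
  map (_+ s) (dec (n ∸ s)) ++ dec s ≡⟨ dec-+ (n ∸ s) s ⟨
  dec (n ∸ s + s)                   ≡⟨ cong dec (m∸n+n≡m s≤n) ⟩
  dec n                             ↭⟨ dec-↭-oneTo n ⟩
  oneTo n                           ∎
  where open PermutationReasoning

pat-layered : ∀ n s → Layered s (pat n s)
pat-layered n s = record
  { low = dec s ; high = map (_+ s) (dec (n ∸ s)) ; split = refl
  ; low-descending = dec-descending s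
  ; high-descending = AllPairsₚ.map⁺ (AllPairs.map (+-monoˡ-< s) (dec-descending (n ∸ s)))
  ; low-≤ = dec-≤ s ; high-> = map-+-dec-> (n ∸ s) s }

pat-avoidsT : ∀ n s → AvoidsT (pat n s)
pat-avoidsT n s = layered-avoidsT (pat-layered n s)

pat-suc-injective : ∀ {n s t} → pat n (suc s) ≡ pat n (suc t) → s ≡ t
pat-suc-injective = suc-injective ∘ ∷-injectiveˡ

length-pat : ∀ {k r} → r ≤ k → length (pat k r) ≡ k
length-pat {k} {r} r≤k = begin
  length (pat k r)
    ≡⟨ length-++ (dec r) ⟩
  length (dec r) + length (map (_+ r) (dec (k ∸ r)))
    ≡⟨ cong₂ _+_ (length-dec r) (trans (length-map _ (dec (k ∸ r))) (length-dec (k ∸ r))) ⟩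
  r + (k ∸ r)
    ≡⟨ m+[n∸m]≡n r≤k ⟩
  k ∎
  where open ≡-Reasoning

at-pat-last-low : ∀ k r → at (pat k (suc r)) r ≡ 1
at-pat-last-low k r = trans (at-++ˡ (dec (suc r)) (subst (r <_) (sym (length-dec (suc r))) ≤-refl)) (last r)
  where
  last : ∀ r → at (dec (suc r)) r ≡ 1
  last zero    = refl
  last (suc r) = last r

at-pat-first-high : ∀ {k r} → r < k → at (pat k r) r ≡ k
at-pat-first-high {k} {r} r<k = begin
  at (pat k r) r
    ≡⟨ at-++ʳ (dec r) (≤-reflexive (length-dec r)) ⟩
  at (map (_+ r) (dec (k ∸ r))) (r ∸ length (dec r))
    ≡⟨ cong (at (map (_+ r) (dec (k ∸ r)))) (trans (cong (r ∸_) (length-dec r)) (n∸n≡0 r)) ⟩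
  at (map (_+ r) (dec (k ∸ r))) 0
    ≡⟨ head-+ (k ∸ r) (m<n⇒0<n∸m r<k) ⟩
  k ∸ r + r
    ≡⟨ m∸n+n≡m (<⇒≤ r<k) ⟩
  k ∎
  where
  open ≡-Reasoning
  head-+ : ∀ m → 0 < m → at (map (_+ r) (dec m)) 0 ≡ m + r
  head-+ (suc m) _ = refl

layered-ordIso-pat : ∀ {s γ k r} (L : Layered s γ) → OrdIso γ (pat k r) → 1 ≤ r → r < k →
                     length (low L) ≡ r
layered-ordIso-pat {k = k} {suc r} L iso _ 1+r<k with ordIso-ascent L iso ≤-refl 1+r<length ascent
  where
  1+r<length : suc r < length (pat k (suc r))
  1+r<length = subst (suc r <_) (sym (length-pat (<⇒≤ 1+r<k))) 1+r<k
  ascent : at (pat k (suc r)) r < at (pat k (suc r)) (suc r)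
  ascent = subst₂ _<_ (sym (at-pat-last-low k r)) (sym (at-pat-first-high 1+r<k)) (≤-<-trans (s≤s z≤n) 1+r<k)
... | r<ℓ , ℓ≤1+r = ≤-antisym ℓ≤1+r r<ℓ

raiseAbove : ℕ → ℕ → ℕ → ℕ
raiseAbove r c x with x ≤? r
... | yes _ = x
... | no  _ = x + c

raiseAbove-strictMono : ∀ r c {a b} → a < b → raiseAbove r c a < raiseAbove r c b
raiseAbove-strictMono r c {a} {b} a<b with a ≤? r | b ≤? r
... | yes _   | yes _   = a<b
... | yes _   | no  _   = <-≤-trans a<b (m≤m+n b c)
... | no  a≰r | yes b≤r = contradiction (≤-trans (<⇒≤ a<b) b≤r) a≰r
... | no  _   | no  _   = +-monoˡ-< c a<b

map-raiseAbove-≤ : ∀ r c {xs} → All (_≤ r) xs → map (raiseAbove r c) xs ≡ xs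
map-raiseAbove-≤ r c []                = refl
map-raiseAbove-≤ r c {x ∷ _} (x≤r ∷ xs≤r) with x ≤? r
... | yes _   = cong (x ∷_) (map-raiseAbove-≤ r c xs≤r)
... | no  x≰r = contradiction x≤r x≰r

map-raiseAbove-> : ∀ r c {xs} → All (r <_) xs → map (raiseAbove r c) xs ≡ map (_+ c) xs
map-raiseAbove-> r c []                = refl
map-raiseAbove-> r c {x ∷ _} (r<x ∷ xs>r) with x ≤? r
... | yes x≤r = contradiction x≤r (<⇒≱ r<x)
... | no  _   = cong (x + c ∷_) (map-raiseAbove-> r c xs>r)

pat-contains-pat : ∀ {n s k r} → r ≤ s → k ∸ r ≤ n ∸ s → Contains (pat n s) (pat k r)
pat-contains-pat {n} {s} {k} {r} r≤s k-r≤n-s =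
  γ , ++⁺ (dec-⊆ r≤s) (map⁺ (_+ s) (dec-⊆ k-r≤n-s)) ,
  subst (λ xs → OrdIso xs (pat k r)) raise≡γ (ordIso-map (raiseAbove-strictMono r (s ∸ r)) (pat k r))
  where
  open ≡-Reasoning
  γ : List ℕ
  γ = dec r ++ map (_+ s) (dec (k ∸ r))
  +r+[s-r] : ∀ x → x + r + (s ∸ r) ≡ x + s
  +r+[s-r] x = trans (+-assoc x r (s ∸ r)) (cong (x +_) (m+[n∸m]≡n r≤s))
  raise≡γ : map (raiseAbove r (s ∸ r)) (pat k r) ≡ γ
  raise≡γ = begin
    map (raiseAbove r (s ∸ r)) (dec r ++ map (_+ r) (dec (k ∸ r)))
      ≡⟨ map-++ _ (dec r) _ ⟩
    map (raiseAbove r (s ∸ r)) (dec r) ++ map (raiseAbove r (s ∸ r)) (map (_+ r) (dec (k ∸ r)))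
      ≡⟨ cong₂ _++_ (map-raiseAbove-≤ r _ (dec-≤ r)) (map-raiseAbove-> r _ (map-+-dec-> (k ∸ r) r)) ⟩
    dec r ++ map (_+ (s ∸ r)) (map (_+ r) (dec (k ∸ r)))
      ≡⟨ cong (dec r ++_) (trans (sym (map-∘ (dec (k ∸ r)))) (map-cong +r+[s-r] (dec (k ∸ r)))) ⟩
    γ ∎

pat-contains-pat⇔ : ∀ {n s k r} → 1 ≤ r → r < k → Contains (pat n s) (pat k r) ⇔ (r ≤ s × k ∸ r ≤ n ∸ s)
pat-contains-pat⇔ {n} {s} {k} {r} 1≤r r<k = mk⇔ bounds (λ (r≤s , k-r≤n-s) → pat-contains-pat r≤s k-r≤n-s)
  where
  bounds : Contains (pat n s) (pat k r) → r ≤ s × k ∸ r ≤ n ∸ s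
  bounds (γ , γ⊆pat , iso) with Layered-⊆ γ⊆pat (pat-layered n s)
  ... | L , low⊆ , high⊆ = subst (_≤ s) ℓ≡r low≤s , subst (_≤ n ∸ s) high≡k-r high≤n-s
    where
    ℓ≡r : length (low L) ≡ r
    ℓ≡r = layered-ordIso-pat L iso 1≤r r<k
    low≤s : length (low L) ≤ s
    low≤s = subst (_ ≤_) (length-dec s) (length-mono-≤ low⊆)
    high≤n-s : length (high L) ≤ n ∸ s
    high≤n-s = subst (_ ≤_) (trans (length-map _ (dec (n ∸ s))) (length-dec (n ∸ s))) (length-mono-≤ high⊆)
    high≡k-r : length (high L) ≡ k ∸ r
    high≡k-r = begin
      length (high L)                                   ≡⟨ m+n∸m≡n (length (low L)) _ ⟨
      length (low L) + length (high L) ∸ length (low L) ≡⟨ cong₂ _∸_ (sym (length-++ (low L))) ℓ≡r ⟩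
      length (low L ++ high L) ∸ r                      ≡⟨ cong (λ xs → length xs ∸ r) (split L) ⟨
      length γ ∸ r                                      ≡⟨ cong (_∸ r) (trans (proj₁ iso) (length-pat (<⇒≤ r<k))) ⟩
      k ∸ r                                             ∎
      where open ≡-Reasoning

-- Classification and counting

∈-oneTo⁻ : ∀ {n y} → y ∈ oneTo n → 1 ≤ y × y ≤ n
∈-oneTo⁻ y∈ with ∈-map⁻ suc y∈
... | x , x∈ , refl = s≤s z≤n , ∈-upTo⁻ x∈

∈-oneTo⁺ : ∀ {n y} → 1 ≤ y → y ≤ n → y ∈ oneTo n
∈-oneTo⁺ {y = suc y} _ y<n = ∈-map⁺ suc (∈-upTo⁺ y<n)

isPerm⇒unique : ∀ {n σ} → IsPerm n σ → Unique σ
isPerm⇒unique {n} σ↭ = Permutationₛ.Unique-resp-↭ (setoid ℕ) (↭⇒↭ₛ (↭-sym σ↭))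
                         (Unique.map⁺ suc-injective (Unique.upTo⁺ n))

avoidsT⇒≡pat : ∀ {k} → 1 ≤ k → ∀ τ → IsPerm k τ → AvoidsT τ → ∃ λ r → 1 ≤ r × r ≤ k × τ ≡ pat k r
avoidsT⇒≡pat 1≤k []         τ↭ _ with ∈-resp-↭ (↭-sym τ↭) (∈-oneTo⁺ ≤-refl 1≤k)
... | ()
avoidsT⇒≡pat {k} _ (x ∷ rest) τ↭ avoids with ∈-oneTo⁻ (∈-resp-↭ τ↭ (here refl))
... | 1≤x , x≤k = x , 1≤x , x≤k ,
  layered-↭⇒≡ (avoidsT⇒layered (isPerm⇒unique τ↭) avoids) (pat-layered k x)
              (↭-trans τ↭ (↭-sym (pat-isPerm x≤k)))

-- The values s − 1 for s ∈ {1, …, r − 1} ∪ {n − (k − r) + 1, …, n}.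
admissible : ℕ → ℕ → ℕ → List ℕ
admissible n k r = upTo (r ∸ 1) ++ map (_+ (n ∸ (k ∸ r))) (upTo (k ∸ r))

length-admissible : ∀ n {k r} → 1 ≤ r → r ≤ k → length (admissible n k r) ≡ k ∸ 1
length-admissible n {suc k} {suc r} _ (s≤s r≤k) = begin
  length (upTo r ++ map (_+ (n ∸ (k ∸ r))) (upTo (k ∸ r)))
    ≡⟨ length-++ (upTo r) ⟩
  length (upTo r) + length (map (_+ (n ∸ (k ∸ r))) (upTo (k ∸ r)))
    ≡⟨ cong₂ _+_ (length-upTo r) (trans (length-map _ (upTo (k ∸ r))) (length-upTo (k ∸ r))) ⟩
  r + (k ∸ r)
    ≡⟨ m+[n∸m]≡n r≤k ⟩
  k ∎
  where open ≡-Reasoning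

<∸1⇔suc< : ∀ {t r} → 1 ≤ r → (t < r ∸ 1) ⇔ (suc t < r)
<∸1⇔suc< {r = suc r} _ = mk⇔ s<s s<s⁻¹

module _ {n k r} (1≤r : 1 ≤ r) (r≤k : r ≤ k) (k≤n : k ≤ n) where

  private
    d c : ℕ
    d = k ∸ r
    c = n ∸ d
    d≤n : d ≤ n
    d≤n = ≤-trans (m∸n≤m k r) k≤n
    n∸c≡d : n ∸ c ≡ d
    n∸c≡d = m∸[m∸n]≡n d≤n
    r≤c : r ≤ c
    r≤c = subst (_≤ c) (m∸[m∸n]≡n r≤k) (∸-monoˡ-≤ d k≤n)

  admissible-unique : Unique (admissible n k r)
  admissible-unique = Unique.++⁺ (Unique.upTo⁺ (r ∸ 1)) (Unique.map⁺ (+-cancelʳ-≡ c _ _) (Unique.upTo⁺ d)) disjoint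
    where
    disjoint : ∀ {t} → ¬ (t ∈ upTo (r ∸ 1) × t ∈ map (_+ c) (upTo d))
    disjoint (t∈low , t∈high) with ∈-map⁻ (_+ c) t∈high
    ... | u , _ , refl = contradiction (≤-trans r≤c (m≤n+m c u))
                           (<⇒≱ (<-trans (n<1+n _) (Equivalence.to (<∸1⇔suc< 1≤r) (∈-upTo⁻ t∈low))))

  ∈-admissible⇔ : ∀ {t} → t ∈ admissible n k r ⇔ (suc t ≤ n × ¬ (r ≤ suc t × d ≤ n ∸ suc t))
  ∈-admissible⇔ {t} = mk⇔ to from
    where
    to : t ∈ admissible n k r → suc t ≤ n × ¬ (r ≤ suc t × d ≤ n ∸ suc t)
    to t∈ with ∈-++⁻ (upTo (r ∸ 1)) t∈
    ... | inj₁ t∈low = ≤-trans (<⇒≤ 1+t<r) (≤-trans r≤k k≤n) , λ (r≤1+t , _) → <⇒≱ 1+t<r r≤1+t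
      where
      1+t<r : suc t < r
      1+t<r = Equivalence.to (<∸1⇔suc< 1≤r) (∈-upTo⁻ t∈low)
    ... | inj₂ t∈high with ∈-map⁻ (_+ c) t∈high
    ...   | u , u∈ , refl = 1+t≤n , λ (_ , d≤n∸[1+t]) → <⇒≱ n∸[1+t]<d d≤n∸[1+t]
      where
      1+t≤n : suc (u + c) ≤ n
      1+t≤n = subst (suc (u + c) ≤_) (m+[n∸m]≡n d≤n) (+-monoˡ-< c (∈-upTo⁻ u∈))
      n∸[1+t]<d : n ∸ suc (u + c) < d
      n∸[1+t]<d = subst (n ∸ suc (u + c) <_) n∸c≡d (∸-monoʳ-< (s≤s (m≤n+m c u)) 1+t≤n)
    from : suc t ≤ n × ¬ (r ≤ suc t × d ≤ n ∸ suc t) → t ∈ admissible n k r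
    from (1+t≤n , ¬bounds) with suc t <? r
    ... | yes 1+t<r = ∈-++⁺ˡ (∈-upTo⁺ (Equivalence.from (<∸1⇔suc< 1≤r) 1+t<r))
    ... | no  1+t≮r = ∈-++⁺ʳ (upTo (r ∸ 1))
                          (subst (_∈ map (_+ c) (upTo d)) (m∸n+n≡m c≤t) (∈-map⁺ (_+ c) (∈-upTo⁺ t∸c<d)))
      where
      n∸[1+t]<d : n ∸ suc t < d
      n∸[1+t]<d = ≰⇒> (λ d≤ → ¬bounds (≮⇒≥ 1+t≮r , d≤))
      c≤t : c ≤ t
      c≤t = s≤s⁻¹ (∸-cancelʳ-< (subst (n ∸ suc t <_) (sym n∸c≡d) n∸[1+t]<d))
      t∸c<d : t ∸ c < d
      t∸c<d = subst (t ∸ c <_) n∸c≡d (∸-monoˡ-< 1+t≤n c≤t)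

avoiders-hasSize : ∀ {n k r} → 1 ≤ r → r < k → k ≤ n → HasSize (InSnTτ n (pat k r)) (k ∸ 1)
avoiders-hasSize {n} {k} {r} 1≤r r<k k≤n =
  map (pat n ∘ suc) ts ,
  Unique.map⁺ (pat-suc-injective {n}) (admissible-unique 1≤r (<⇒≤ r<k) k≤n) ,
  trans (length-map _ ts) (length-admissible n 1≤r (<⇒≤ r<k)) ,
  λ σ → mk⇔ to from
  where
  ts : List ℕ
  ts = admissible n k r
  to : ∀ {σ} → σ ∈ map (pat n ∘ suc) ts → InSnTτ n (pat k r) σ
  to σ∈ with ∈-map⁻ (pat n ∘ suc) σ∈
  ... | t , t∈ts , refl with Equivalence.to (∈-admissible⇔ {n} 1≤r (<⇒≤ r<k) k≤n) t∈ts
  ...   | 1+t≤n , ¬bounds = pat-isPerm 1+t≤n , pat-avoidsT n (suc t) ,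
                            ¬bounds ∘ Equivalence.to (pat-contains-pat⇔ {n} 1≤r r<k)
  from : ∀ {σ} → InSnTτ n (pat k r) σ → σ ∈ map (pat n ∘ suc) ts
  from (σ↭ , avoidsT , avoids) with avoidsT⇒≡pat (≤-trans 1≤r (≤-trans (<⇒≤ r<k) k≤n)) _ σ↭ avoidsT
  ... | zero  , () , _
  ... | suc t , _ , 1+t≤n , refl = ∈-map⁺ (pat n ∘ suc)
    (Equivalence.from (∈-admissible⇔ {n} 1≤r (<⇒≤ r<k) k≤n)
      (1+t≤n , avoids ∘ Equivalence.from (pat-contains-pat⇔ {n} 1≤r r<k)))

theorem8 : (k : ℕ) → 1 ≤ k →
    ((τ : List ℕ) → IsPerm k τ → AvoidsT τ →
       ∃ λ r → 1 ≤ r × r ≤ k × τ ≡ pat k r)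
    ×
    ((r : ℕ) → 1 ≤ r → r ≤ k ∸ 1 → (n : ℕ) → k ≤ n →
       HasSize (InSnTτ n (pat k r)) (k ∸ 1))
theorem8 (suc k) 1≤k = avoidsT⇒≡pat 1≤k , λ r 1≤r r≤k n 1+k≤n → avoiders-hasSize 1≤r (s≤s r≤k) 1+k≤n
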